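{- Let $\Gamma=\langle X,\sqsubseteq\rangle$ and $\Gamma^\sharp=\langle X^\sharp,\subseteq\rangle$ be posets and $\gamma:X^\sharp\to X$ a monotone function. Suppose $\Gamma$ is an almost complete meet-semilattice with a least element $\bot$, and $\Gamma^\sharp$ has a least element $\bot_\sharp$ with $\gamma.\bot_\sharp=\bot$. Let $f:X\to X$ be monotone and let $f^\sharp:X^\sharp\to X^\sharp$ be a b-abstraction of $f$. Suppose $f$ has a pre-fixed point in $X$ (so that $f$ has a least fixed point $\mu.f$). Then: (1) the supremum $\bigsqcup_{i\in\mathbb{N}}\gamma.(f^{\sharp(i)}.\bot_\sharp)$ exists in $X$ and $\bigsqcup_{i\in\mathbb{N}}\gamma.(f^{\sharp(i)}.\bot_\sharp)\sqsubseteq\mu.f$; (2) if $\bigsqcup_{i\in\mathbb{N}}\gamma.(f^{\sharp(i)}.\bot_\sharp)$ is a pre-fixed point of $f$, then $\bigsqcup_{i\in\mathbb{N}}\gamma.(f^{\sharp(i)}.\bot_\sharp)=\mu.f$.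
   Context: An almost complete meet-semilattice is a poset in which every pair of elements has a greatest lower bound and every nonempty subset has a greatest lower bound (infimum). An element $x$ is a pre-fixed point of $f$ if $f.x\sqsubseteq x$; $\mu.f$ denotes the least fixed point of $f$. Given a monotone $f:X\to X$, a function $f^\sharp:X^\sharp\to X^\sharp$ is a b-abstraction of $f$ if for all $x\in X$ and $x^\sharp\in X^\sharp$ with $\gamma.x^\sharp\sqsubseteq x$ one has $\gamma.(f^\sharp.x^\sharp)\sqsubseteq f.x$. $f^{\sharp(i)}$ denotes the $i$-fold iterate of $f^\sharp$ ($f^{\sharp(0)}$ the identity). -}

module Defs where

open import Level using (Level; _⊔_)
open import Data.Nat using (ℕ; zero; suc)
open import Data.Product using (Σ; _×_; ∃)
open import Relation.Unary using (Pred)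
open import Relation.Binary.Bundles using (Poset)

iter : ∀ {a} {A : Set a} → (A → A) → ℕ → A → A
iter f zero    x = x
iter f (suc i) x = f (iter f i x)

module PosetNotions {c ℓ₁ ℓ₂ : Level} (P : Poset c ℓ₁ ℓ₂) where
  open Poset P renaming (Carrier to X)

  Subset : Set _
  Subset = Pred X (c ⊔ ℓ₁ ⊔ ℓ₂)

  IsLowerBound : Subset → X → Set _
  IsLowerBound S m = ∀ x → S x → m ≤ x

  IsInfimum : Subset → X → Set _
  IsInfimum S m = IsLowerBound S m × (∀ y → IsLowerBound S y → y ≤ m)

  IsGlbOfPair : X → X → X → Set _
  IsGlbOfPair x y m = (m ≤ x × m ≤ y) × (∀ z → z ≤ x → z ≤ y → z ≤ m)

  Nonempty : Subset → Set _
  Nonempty S = ∃ λ x → S x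

  IsAlmostCompleteMeetSemilattice : Set _
  IsAlmostCompleteMeetSemilattice =
    (∀ x y → ∃ λ m → IsGlbOfPair x y m)
    × (∀ S → Nonempty S → ∃ λ m → IsInfimum S m)

  IsLeast : X → Set _
  IsLeast b = ∀ x → b ≤ x

  Monotone : (X → X) → Set _
  Monotone f = ∀ {x y} → x ≤ y → f x ≤ f y

  IsPreFixedPoint : (X → X) → X → Set _
  IsPreFixedPoint f x = f x ≤ x

  IsFixedPoint : (X → X) → X → Set _
  IsFixedPoint f x = f x ≈ x

  IsLeastFixedPoint : (X → X) → X → Set _
  IsLeastFixedPoint f m = IsFixedPoint f m × (∀ x → IsFixedPoint f x → m ≤ x)

  IsSupremumℕ : (ℕ → X) → X → Set _
  IsSupremumℕ g s = (∀ i → g i ≤ s) × (∀ y → (∀ i → g i ≤ y) → s ≤ y)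

MonotoneBetween : ∀ {c ℓ₁ ℓ₂ c' ℓ₁' ℓ₂'} (P : Poset c ℓ₁ ℓ₂) (Q : Poset c' ℓ₁' ℓ₂')
  → (Poset.Carrier Q → Poset.Carrier P) → Set _
MonotoneBetween P Q γ = ∀ {a b} → Poset._≤_ Q a b → Poset._≤_ P (γ a) (γ b)

IsBAbstraction : ∀ {c ℓ₁ ℓ₂ c' ℓ₁' ℓ₂'} (P : Poset c ℓ₁ ℓ₂) (Q : Poset c' ℓ₁' ℓ₂')
  → (Poset.Carrier Q → Poset.Carrier P)
  → (Poset.Carrier P → Poset.Carrier P) → (Poset.Carrier Q → Poset.Carrier Q) → Set _
IsBAbstraction P Q γ f f♯ =
  ∀ x x♯ → Poset._≤_ P (γ x♯) x → Poset._≤_ P (γ (f♯ x♯)) (f x)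

module Submission where

-- The proof rests on two facts about posets:
--   * the infimum of the pre-fixed points of a monotone f is its least fixed
--     point and lies below every pre-fixed point (Knaster–Tarski), and
--   * the infimum of the upper bounds of a family is its supremum.
-- In an almost complete meet-semilattice these infima exist as soon as the
-- relevant sets are nonempty, which gives the least fixed point μf (the
-- pre-fixed point of the hypothesis makes its set nonempty) and the supremum
-- of any family bounded above.  A b-abstraction step cannot leave the region
-- below a pre-fixed point, so every γ (f♯ⁱ ⊥♯) lies below μf; hence the
-- supremum s of these iterates exists and s ⊑ μf.  Finally, if s is itself a
-- pre-fixed point then μf ⊑ s, so s = μf.

open import Defs
open import Level using (Level; _⊔_; Lift; lift; lower)
open import Data.Nat using (ℕ; zero; suc)
open import Data.Product using (_×_; ∃; _,_; proj₁; proj₂)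
open import Relation.Binary.Bundles using (Poset)

module InfimumFacts {c ℓ₁ ℓ₂ : Level} (Γ : Poset c ℓ₁ ℓ₂) where
  open Poset Γ renaming (Carrier to X)
  open PosetNotions Γ

  PreFixedPoints : (X → X) → Subset
  PreFixedPoints f x = Lift (c ⊔ ℓ₁) (IsPreFixedPoint f x)

  UpperBounds : (ℕ → X) → Subset
  UpperBounds g y = Lift (c ⊔ ℓ₁) (∀ i → g i ≤ y)

  infimum-of-pre-fixed-points : ∀ {f m} → Monotone f
    → IsInfimum (PreFixedPoints f) m
    → IsLeastFixedPoint f m × (∀ p → IsPreFixedPoint f p → m ≤ p)
  infimum-of-pre-fixed-points {f} {m} f-mono (m-lower , m-greatest) =
    (antisym fm≤m m≤fm , λ x fx≈x → below-pre-fixed x (reflexive fx≈x))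
    , below-pre-fixed
    where
    below-pre-fixed : ∀ p → IsPreFixedPoint f p → m ≤ p
    below-pre-fixed p fp≤p = m-lower p (lift fp≤p)

    -- f m is a lower bound of the pre-fixed points, since f m ≤ f p ≤ p.
    fm≤m : f m ≤ m
    fm≤m = m-greatest (f m) λ p fp≤p →
      trans (f-mono (m-lower p fp≤p)) (lower fp≤p)

    -- Monotonicity turns f m ≤ m into f (f m) ≤ f m, so f m is pre-fixed.
    m≤fm : m ≤ f m
    m≤fm = below-pre-fixed (f m) (f-mono fm≤m)

  infimum-of-upper-bounds : ∀ {g s} → IsInfimum (UpperBounds g) s → IsSupremumℕ g s
  infimum-of-upper-bounds {g} (s-lower , s-greatest) =
    (λ i → s-greatest (g i) λ y gy → lower gy i)
    , (λ y g≤y → s-lower y (lift g≤y))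

module WithInfima {c ℓ₁ ℓ₂ : Level} (Γ : Poset c ℓ₁ ℓ₂)
  (hasInfima : ∀ S → PosetNotions.Nonempty Γ S → ∃ λ m → PosetNotions.IsInfimum Γ S m)
  where
  open Poset Γ renaming (Carrier to X)
  open PosetNotions Γ
  open InfimumFacts Γ

  knaster-tarski : ∀ {f} → Monotone f → ∃ (IsPreFixedPoint f)
    → ∃ λ m → IsLeastFixedPoint f m × (∀ p → IsPreFixedPoint f p → m ≤ p)
  knaster-tarski f-mono (x , fx≤x) with hasInfima (PreFixedPoints _) (x , lift fx≤x)
  ... | m , m-inf = m , infimum-of-pre-fixed-points f-mono m-inf

  -- Any least fixed point (not only the constructed one) is below every
  -- pre-fixed point: it is below the Knaster–Tarski fixed point m ≤ p.
  least-fixed-point-below-pre-fixed : ∀ {f μf p} → Monotone f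
    → IsLeastFixedPoint f μf → IsPreFixedPoint f p → μf ≤ p
  least-fixed-point-below-pre-fixed {p = p} f-mono (_ , μf-least) fp≤p
    with knaster-tarski f-mono (p , fp≤p)
  ... | m , (m-fixed , _) , m-below = trans (μf-least m m-fixed) (m-below p fp≤p)

  supremum-of-bounded-family : ∀ {g b} → (∀ i → g i ≤ b) → ∃ (IsSupremumℕ g)
  supremum-of-bounded-family {g} {b} g≤b with hasInfima (UpperBounds g) (b , lift g≤b)
  ... | s , s-inf = s , infimum-of-upper-bounds s-inf

abstract-iterates-below-pre-fixed : ∀ {c ℓ₁ ℓ₂ c' ℓ₁' ℓ₂'}
  (Γ : Poset c ℓ₁ ℓ₂) (Γ♯ : Poset c' ℓ₁' ℓ₂') (γ : Poset.Carrier Γ♯ → Poset.Carrier Γ)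
  {f : Poset.Carrier Γ → Poset.Carrier Γ} {f♯ : Poset.Carrier Γ♯ → Poset.Carrier Γ♯}
  → IsBAbstraction Γ Γ♯ γ f f♯
  → ∀ {p x♯} → PosetNotions.IsPreFixedPoint Γ f p → Poset._≤_ Γ (γ x♯) p
  → ∀ i → Poset._≤_ Γ (γ (iter f♯ i x♯)) p
abstract-iterates-below-pre-fixed Γ Γ♯ γ f♯-abs fp≤p γx♯≤p zero = γx♯≤p
abstract-iterates-below-pre-fixed Γ Γ♯ γ {f♯ = f♯} f♯-abs {p} {x♯} fp≤p γx♯≤p (suc i) =
  Poset.trans Γ
    (f♯-abs p (iter f♯ i x♯) (abstract-iterates-below-pre-fixed Γ Γ♯ γ f♯-abs fp≤p γx♯≤p i))
    fp≤p

mainTheorem2 : ∀ {c ℓ₁ ℓ₂ c' ℓ₁' ℓ₂' : Level}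
    (Γ : Poset c ℓ₁ ℓ₂) (Γ♯ : Poset c' ℓ₁' ℓ₂')
    (γ : Poset.Carrier Γ♯ → Poset.Carrier Γ) → MonotoneBetween Γ Γ♯ γ
    → PosetNotions.IsAlmostCompleteMeetSemilattice Γ
    → (⊥ : Poset.Carrier Γ) → PosetNotions.IsLeast Γ ⊥
    → (⊥♯ : Poset.Carrier Γ♯) → PosetNotions.IsLeast Γ♯ ⊥♯
    → Poset._≈_ Γ (γ ⊥♯) ⊥
    → (f : Poset.Carrier Γ → Poset.Carrier Γ) → PosetNotions.Monotone Γ f
    → (f♯ : Poset.Carrier Γ♯ → Poset.Carrier Γ♯) → IsBAbstraction Γ Γ♯ γ f f♯
    → (∃ λ x → PosetNotions.IsPreFixedPoint Γ f x)
    → (∃ λ μf → PosetNotions.IsLeastFixedPoint Γ f μf)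
      × (∀ μf → PosetNotions.IsLeastFixedPoint Γ f μf
         → ∃ λ s → PosetNotions.IsSupremumℕ Γ (λ i → γ (iter f♯ i ⊥♯)) s
             × Poset._≤_ Γ s μf
             × (PosetNotions.IsPreFixedPoint Γ f s → Poset._≈_ Γ s μf))
mainTheorem2 Γ Γ♯ γ _ (_ , hasInfima) ⊥ ⊥-least ⊥♯ _ γ⊥♯≈⊥ f f-mono f♯ f♯-abs pre-fixed =
  least-fixed-point , approximation
  where
  open Poset Γ renaming (Carrier to X)
  open PosetNotions Γ using (IsLeastFixedPoint; IsSupremumℕ; IsPreFixedPoint)
  open WithInfima Γ hasInfima

  least-fixed-point : ∃ (IsLeastFixedPoint f)
  least-fixed-point with knaster-tarski f-mono pre-fixed
  ... | μf , μf-lfp , _ = μf , μf-lfp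

  approximation : ∀ μf → IsLeastFixedPoint f μf
    → ∃ λ s → IsSupremumℕ (λ i → γ (iter f♯ i ⊥♯)) s
        × s ≤ μf × (IsPreFixedPoint f s → s ≈ μf)
  approximation μf μf-lfp = s , s-sup , s≤μf , λ fs≤s → antisym s≤μf (μf≤pre-fixed fs≤s)
    where
    iterates≤μf : ∀ i → γ (iter f♯ i ⊥♯) ≤ μf
    iterates≤μf = abstract-iterates-below-pre-fixed Γ Γ♯ γ f♯-abs
      (reflexive (proj₁ μf-lfp)) (trans (reflexive γ⊥♯≈⊥) (⊥-least μf))

    s : X
    s = proj₁ (supremum-of-bounded-family iterates≤μf)

    s-sup : IsSupremumℕ (λ i → γ (iter f♯ i ⊥♯)) s
    s-sup = proj₂ (supremum-of-bounded-family iterates≤μf)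

    s≤μf : s ≤ μf
    s≤μf = proj₂ s-sup μf iterates≤μf

    μf≤pre-fixed : f s ≤ s → μf ≤ s
    μf≤pre-fixed = least-fixed-point-below-pre-fixed f-mono μf-lfp
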